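{- For every positive integer $n$, $$\Phi^{(4)}[aq^n; b; c, c'; x, y] = \Phi^{(4)}[a; b; c, c'; x, y] + \frac{ax(1-b)}{1-c} \sum_{k=1}^n q^{k-1} \Phi^{(4)}[aq^k; bq; cq, c'; x, y] + \frac{ay(1-b)}{1-c'} \sum_{k=1}^n q^{k-1} \Phi^{(4)}[aq^k; bq; c, c'q; xq, y],$$ and $$\Phi^{(4)}[aq^{ -n}; b; c, c'; x, y] = \Phi^{(4)}[a; b; c, c'; x, y] - \frac{ax(1-b)}{1-c} \sum_{k=1}^n q^{ -k} \Phi^{(4)}[aq^{1-k}; bq; cq, c'; x, y] - \frac{ay(1-b)}{1-c'} \sum_{k=1}^n q^{ -k} \Phi^{(4)}[aq^{1-k}; bq; c, c'q; xq, y].$$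
   Context: Let $q$ be a complex number with $|q|<1$. For a complex number $z$ and an integer $N\ge 0$, $(z;q)_N=\prod_{j=0}^{N-1}(1-zq^j)$. The $q$-Appell function $\Phi^{(4)}$ is $$\Phi^{(4)}[a; b; c, c'; x, y] = \sum_{m, n \geq 0} \frac{(a; q)_{m+n} (b; q)_{m+n}}{(q; q)_m (q; q)_n (c; q)_m (c'; q)_n} x^m y^n .$$ All identities are understood as identities of power series in $x,y$ (convergent for $|x|,|y|$ sufficiently small), with parameters generic so that no denominator appearing vanishes. -}

module Defs where

open import Level using (Level; _⊔_) renaming (suc to lsuc)
open import Data.Nat using (ℕ; zero; suc) renaming (_+_ to _+ℕ_)
open import Relation.Nullary using (¬_)
open import Algebra.Bundles using (CommutativeRing)

-- A field: a commutative ring with 0 ≠ 1 and a total inverse operation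
-- which is a genuine inverse on every nonzero element (value at 0 irrelevant).
record Field (c ℓ : Level) : Set (lsuc (c ⊔ ℓ)) where
  field
    commutativeRing : CommutativeRing c ℓ
  open CommutativeRing commutativeRing public
  field
    _⁻¹       : Carrier → Carrier
    0≉1       : ¬ (0# ≈ 1#)
    inverseʳ  : ∀ x → ¬ (x ≈ 0#) → x * (x ⁻¹) ≈ 1#
  infix 8 _⁻¹

module FieldDefs {c ℓ : Level} (F : Field c ℓ) where
  open Field F

  pow : Carrier → ℕ → Carrier
  pow z zero    = 1#
  pow z (suc n) = pow z n * z

  poch : Carrier → Carrier → ℕ → Carrier
  poch z q zero    = 1#
  poch z q (suc N) = poch z q N * (1# - z * pow q N)

  -- formal power series in two variables x, y:
  -- s m n is the coefficient of x^m y^n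
  Series : Set c
  Series = ℕ → ℕ → Carrier

  Φ4 : (q a b c c' : Carrier) → Series
  Φ4 q a b c c' m n =
    (poch a q (m +ℕ n) * poch b q (m +ℕ n)) *
    (poch q q m * poch q q n * poch c q m * poch c' q n) ⁻¹

  -- the substitution x ↦ s x
  substX : Carrier → Series → Series
  substX s f m n = pow s m * f m n

  mulX : Series → Series
  mulX f zero    n = 0#
  mulX f (suc m) n = f m n

  mulY : Series → Series
  mulY f m zero    = 0#
  mulY f m (suc n) = f m n

  _·_ : Carrier → Series → Series
  (r · f) m n = r * f m n

  _⊕_ : Series → Series → Series
  (f ⊕ g) m n = f m n + g m n

  _⊖_ : Series → Series → Series
  (f ⊖ g) m n = f m n - g m n

  zeroS : Series
  zeroS m n = 0#

  sum1 : ℕ → (ℕ → Series) → Series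
  sum1 zero    g = zeroS
  sum1 (suc n) g = sum1 n g ⊕ g (suc n)

  _≋_ : Series → Series → Set ℓ
  f ≋ g = ∀ m n → f m n ≈ g m n

  infixl 6 _⊕_ _⊖_
  infixl 7 _·_
  infix 4 _≋_

-- Everything rests on one shift relation (the case n = 1):
--   Φ[aq; b; c, c'] = Φ[a; b; c, c'] + a·Δ(aq),
--   Δ(a) = (1-b)/(1-c) · x Φ[a; bq; cq, c'; x, y] + (1-b)/(1-c') · y Φ[a; bq; c, c'q; xq, y].
-- At the coefficient of x^m y^n, after clearing the denominator (q;q)_m (q;q)_n (c;q)_m (c';q)_n,
-- it is the factorisation  1 - a q^(m+n) = (1-a) + a(1-q^m) + a q^m (1-q^n)  of the last factor
-- of (aq;q)_(m+n), multiplied by (aq;q)_(m+n-1) (b;q)_(m+n).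
-- Any relation Φ(aq) = Φ(a) + a·Δ(aq) telescopes, upwards to Φ(aqⁿ) = Φ(a) + a Σ q^(k-1) Δ(aq^k)
-- and, for r = q⁻¹, downwards to Φ(arⁿ) = Φ(a) - a Σ r^k Δ(aq r^k); the sums of Δ split into the
-- two sums of the statement because multiplication by x and by y are linear maps of series.

module Submission where

open import Defs
open import Level using (Level; _⊔_)
open import Data.Nat using (ℕ; zero; suc; _∸_) renaming (_+_ to _+ℕ_)
open import Data.Nat.Properties using (suc-injective; +-suc)
open import Data.Product using (_×_; _,_)
open import Relation.Nullary using (¬_)
import Relation.Binary.PropositionalEquality as P
import Relation.Binary.Reasoning.Setoid as SetoidReasoning
import Algebra.Properties.Ring as RingProperties
import Algebra.Solver.Ring.NaturalCoefficients.Default as NatCoefficientSolver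

module Proof {ℓc ℓ : Level} (F : Field ℓc ℓ) where
  open Field F hiding (zero)
  open FieldDefs F
  open RingProperties ring using (//-rightDividesʳ; -‿+-comm; -0#≈0#; x[y-z]≈xy-xz)
  open NatCoefficientSolver commutativeSemiring using (solve; _:=_; _:+_; _:*_)
  open SetoidReasoning setoid

  inverseˡ : ∀ {x} → ¬ x ≈ 0# → x ⁻¹ * x ≈ 1#
  inverseˡ {x} x≉0 = trans (*-comm (x ⁻¹) x) (inverseʳ x x≉0)

  *-nonzero : ∀ {x y} → ¬ x ≈ 0# → ¬ y ≈ 0# → ¬ x * y ≈ 0#
  *-nonzero {x} {y} x≉0 y≉0 xy≈0 = y≉0 (begin
    y               ≈⟨ sym (*-identityˡ y) ⟩
    1# * y          ≈⟨ *-congʳ (sym (inverseˡ x≉0)) ⟩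
    x ⁻¹ * x * y    ≈⟨ *-assoc (x ⁻¹) x y ⟩
    x ⁻¹ * (x * y)  ≈⟨ *-congˡ xy≈0 ⟩
    x ⁻¹ * 0#       ≈⟨ zeroʳ (x ⁻¹) ⟩
    0#              ∎)

  factor-nonzero : ∀ {d e k} → d ≈ e * k → ¬ d ≈ 0# → ¬ e ≈ 0#
  factor-nonzero {k = k} d≈ek d≉0 e≈0 = d≉0 (trans d≈ek (trans (*-congʳ e≈0) (zeroˡ k)))

  mul-div : ∀ x {d} → ¬ d ≈ 0# → x * d * d ⁻¹ ≈ x
  mul-div x {d} d≉0 = trans (*-assoc x d (d ⁻¹)) (trans (*-congˡ (inverseʳ d d≉0)) (*-identityʳ x))

  div-mul : ∀ x {d} → ¬ d ≈ 0# → x * d ⁻¹ * d ≈ x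
  div-mul x {d} d≉0 = trans (*-assoc x (d ⁻¹) d) (trans (*-congˡ (inverseˡ d≉0)) (*-identityʳ x))

  *-cancelʳ-nonzero : ∀ {d x y} → ¬ d ≈ 0# → x * d ≈ y * d → x ≈ y
  *-cancelʳ-nonzero {d} {x} {y} d≉0 xd≈yd =
    trans (sym (mul-div x d≉0)) (trans (*-congʳ xd≈yd) (mul-div y d≉0))

  one-minus-* : ∀ u v → 1# - u * v ≈ (1# - u) + u * (1# - v)
  one-minus-* u v = sym (begin
    (1# - u) + u * (1# - v)      ≈⟨ +-congˡ (x[y-z]≈xy-xz u 1# v) ⟩
    (1# - u) + (u * 1# - u * v)  ≈⟨ +-congˡ (+-congʳ (*-identityʳ u)) ⟩
    (1# - u) + (u - u * v)       ≈⟨ +-assoc 1# (- u) (u - u * v) ⟩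
    1# + (- u + (u - u * v))     ≈⟨ +-congˡ (sym (+-assoc (- u) u (- (u * v)))) ⟩
    1# + ((- u + u) - u * v)     ≈⟨ +-congˡ (+-congʳ (-‿inverseˡ u)) ⟩
    1# + (0# - u * v)            ≈⟨ +-congˡ (+-identityˡ (- (u * v))) ⟩
    1# - u * v                   ∎)

  three-term-split : ∀ a x y → 1# - a * (x * y) ≈ (1# - a) + a * ((1# - x) + x * (1# - y))
  three-term-split a x y =
    trans (one-minus-* a (x * y)) (+-congˡ (*-congˡ (one-minus-* x y)))

  isolate : ∀ {x y u} → y + u ≈ x → y ≈ x - u
  isolate {y = y} {u = u} y+u≈x = trans (sym (//-rightDividesʳ u y)) (+-congʳ y+u≈x)

  minus-+ : ∀ x u v → x - (u + v) ≈ x - u - v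
  minus-+ x u v = trans (+-congˡ (sym (-‿+-comm u v))) (sym (+-assoc x (- u) (- v)))

  factor-out : ∀ a s p d → a * s + a * p * d ≈ a * (s + p * d)
  factor-out a s p d = trans (+-congˡ (*-assoc a p d)) (sym (distribˡ a s (p * d)))

  pow-+ : ∀ z i j → pow z (i +ℕ j) ≈ pow z i * pow z j
  pow-+ z zero    j = sym (*-identityˡ (pow z j))
  pow-+ z (suc i) j = begin
    pow z (i +ℕ j) * z     ≈⟨ *-congʳ (pow-+ z i j) ⟩
    pow z i * pow z j * z  ≈⟨ solve 3 (λ u v w → u :* v :* w := u :* w :* v) refl (pow z i) (pow z j) z ⟩
    pow z i * z * pow z j  ∎

  poch-cong : ∀ {z z'} q N → z ≈ z' → poch z q N ≈ poch z' q N
  poch-cong q zero    z≈z' = refl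
  poch-cong q (suc N) z≈z' = *-cong (poch-cong q N z≈z') (+-congˡ (-‿cong (*-congʳ z≈z')))

  poch-peel : ∀ z q N → poch z q (suc N) ≈ (1# - z) * poch (z * q) q N
  poch-peel z q zero = begin
    1# * (1# - z * 1#)  ≈⟨ *-identityˡ _ ⟩
    1# - z * 1#         ≈⟨ +-congˡ (-‿cong (*-identityʳ z)) ⟩
    1# - z              ≈⟨ sym (*-identityʳ _) ⟩
    (1# - z) * 1#       ∎
  poch-peel z q (suc N) = begin
    poch z q (suc N) * (1# - z * (pow q N * q))
      ≈⟨ *-cong (poch-peel z q N) (+-congˡ (-‿cong (solve 3 (λ u v w → u :* (v :* w) := u :* w :* v) refl z (pow q N) q))) ⟩
    (1# - z) * poch (z * q) q N * (1# - z * q * pow q N)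
      ≈⟨ *-assoc _ _ _ ⟩
    (1# - z) * (poch (z * q) q N * (1# - z * q * pow q N)) ∎

  poch-nonzero : ∀ z q → (∀ j → ¬ 1# - z * pow q j ≈ 0#) → ∀ N → ¬ poch z q N ≈ 0#
  poch-nonzero z q factors≉0 zero    1≈0 = 0≉1 (sym 1≈0)
  poch-nonzero z q factors≉0 (suc N) = *-nonzero (poch-nonzero z q factors≉0 N) (factors≉0 N)

  den : (q c c' : Carrier) → ℕ → ℕ → Carrier
  den q c c' m n = poch q q m * poch q q n * poch c q m * poch c' q n

  Φ4-clear : ∀ {q a b c c'} m n {N} → m +ℕ n P.≡ N → ¬ den q c c' m n ≈ 0# →
             Φ4 q a b c c' m n * den q c c' m n ≈ poch a q N * poch b q N
  Φ4-clear m n P.refl den≉0 = div-mul _ den≉0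

  Φ4-cong : ∀ {q a a'} b c c' → a ≈ a' → Φ4 q a b c c' ≋ Φ4 q a' b c c'
  Φ4-cong b c c' a≈a' m n = *-congʳ (*-congʳ (poch-cong _ (m +ℕ n) a≈a'))

  den-peelX : ∀ q c c' i j → den q c c' (suc i) j ≈ den q (c * q) c' i j * ((1# - pow q (suc i)) * (1# - c))
  den-peelX q c c' i j = begin
    poch q q i * (1# - q * pow q i) * poch q q j * poch c q (suc i) * poch c' q j
      ≈⟨ *-congʳ (*-cong (*-congʳ (*-congˡ (+-congˡ (-‿cong (*-comm q (pow q i)))))) (poch-peel c q i)) ⟩
    poch q q i * (1# - pow q (suc i)) * poch q q j * ((1# - c) * poch (c * q) q i) * poch c' q j
      ≈⟨ solve 6 (λ u o v oc w z → u :* o :* v :* (oc :* w) :* z := u :* v :* w :* z :* (o :* oc)) refl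
               (poch q q i) (1# - pow q (suc i)) (poch q q j) (1# - c) (poch (c * q) q i) (poch c' q j) ⟩
    den q (c * q) c' i j * ((1# - pow q (suc i)) * (1# - c)) ∎

  den-peelY : ∀ q c c' i j → den q c c' i (suc j) ≈ den q c (c' * q) i j * ((1# - pow q (suc j)) * (1# - c'))
  den-peelY q c c' i j = begin
    poch q q i * (poch q q j * (1# - q * pow q j)) * poch c q i * poch c' q (suc j)
      ≈⟨ *-cong (*-congʳ (*-congˡ (*-congˡ (+-congˡ (-‿cong (*-comm q (pow q j))))))) (poch-peel c' q j) ⟩
    poch q q i * (poch q q j * (1# - pow q (suc j))) * poch c q i * ((1# - c') * poch (c' * q) q j)
      ≈⟨ solve 6 (λ u v o w oc z → u :* (v :* o) :* w :* (oc :* z) := u :* v :* w :* z :* (o :* oc)) refl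
               (poch q q i) (poch q q j) (1# - pow q (suc j)) (poch c q i) (1# - c') (poch (c' * q) q j) ⟩
    den q c (c' * q) i j * ((1# - pow q (suc j)) * (1# - c')) ∎

  record IsLinear (L : Series → Series) : Set (ℓc ⊔ ℓ) where
    field
      cong        : ∀ {f g} → f ≋ g → L f ≋ L g
      additive    : ∀ f g → L (f ⊕ g) ≋ L f ⊕ L g
      homogeneous : ∀ r f → L (r · f) ≋ r · L f
      vanishes    : L zeroS ≋ zeroS

  mulX-linear : IsLinear mulX
  mulX-linear = record { cong = cong ; additive = additive ; homogeneous = homogeneous ; vanishes = vanishes }
    where
    cong : ∀ {f g} → f ≋ g → mulX f ≋ mulX g
    cong f≋g zero    n = refl
    cong f≋g (suc m) n = f≋g m n
    additive : ∀ f g → mulX (f ⊕ g) ≋ mulX f ⊕ mulX g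
    additive f g zero    n = sym (+-identityʳ 0#)
    additive f g (suc m) n = refl
    homogeneous : ∀ r f → mulX (r · f) ≋ r · mulX f
    homogeneous r f zero    n = sym (zeroʳ r)
    homogeneous r f (suc m) n = refl
    vanishes : mulX zeroS ≋ zeroS
    vanishes zero    n = refl
    vanishes (suc m) n = refl

  mulY-linear : IsLinear mulY
  mulY-linear = record { cong = cong ; additive = additive ; homogeneous = homogeneous ; vanishes = vanishes }
    where
    cong : ∀ {f g} → f ≋ g → mulY f ≋ mulY g
    cong f≋g m zero    = refl
    cong f≋g m (suc n) = f≋g m n
    additive : ∀ f g → mulY (f ⊕ g) ≋ mulY f ⊕ mulY g
    additive f g m zero    = sym (+-identityʳ 0#)
    additive f g m (suc n) = refl
    homogeneous : ∀ r f → mulY (r · f) ≋ r · mulY f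
    homogeneous r f m zero    = sym (zeroʳ r)
    homogeneous r f m (suc n) = refl
    vanishes : mulY zeroS ≋ zeroS
    vanishes m zero    = refl
    vanishes m (suc n) = refl

  sum1-split : ∀ {L M} → IsLinear L → IsLinear M → ∀ κ κ' (w : ℕ → Carrier) (A B : ℕ → Series) n →
    sum1 n (λ k → w k · (κ · L (A k) ⊕ κ' · M (B k)))
      ≋ κ · L (sum1 n (λ k → w k · A k)) ⊕ κ' · M (sum1 n (λ k → w k · B k))
  sum1-split {L} {M} linL linM κ κ' w A B zero i j = sym (begin
    κ * L zeroS i j + κ' * M zeroS i j  ≈⟨ +-cong (*-congˡ (IsLinear.vanishes linL i j)) (*-congˡ (IsLinear.vanishes linM i j)) ⟩
    κ * 0# + κ' * 0#                    ≈⟨ +-cong (zeroʳ κ) (zeroʳ κ') ⟩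
    0# + 0#                             ≈⟨ +-identityʳ 0# ⟩
    0#                                  ∎)
  sum1-split {L} {M} linL linM κ κ' w A B (suc n) i j = begin
    sum1 n (λ k → w k · (κ · L (A k) ⊕ κ' · M (B k))) i j + w' * (κ * LA + κ' * MB)
      ≈⟨ +-congʳ (sum1-split linL linM κ κ' w A B n i j) ⟩
    κ * L SA i j + κ' * M SB i j + w' * (κ * LA + κ' * MB)
      ≈⟨ solve 7 (λ k k' u v x y z → k :* u :+ k' :* v :+ x :* (k :* y :+ k' :* z) := k :* (u :+ x :* y) :+ k' :* (v :+ x :* z))
               refl κ κ' (L SA i j) (M SB i j) w' LA MB ⟩
    κ * (L SA i j + w' * LA) + κ' * (M SB i j + w' * MB)
      ≈⟨ sym (+-cong (*-congˡ (image-step linL SA (A (suc n)))) (*-congˡ (image-step linM SB (B (suc n))))) ⟩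
    κ * L (SA ⊕ w' · A (suc n)) i j + κ' * M (SB ⊕ w' · B (suc n)) i j ∎
    where
    w' : Carrier
    w' = w (suc n)
    SA SB : Series
    SA = sum1 n (λ k → w k · A k)
    SB = sum1 n (λ k → w k · B k)
    LA MB : Carrier
    LA = L (A (suc n)) i j
    MB = M (B (suc n)) i j
    image-step : ∀ {N} → IsLinear N → ∀ S T → N (S ⊕ w' · T) i j ≈ N S i j + w' * N T i j
    image-step linN S T = trans (IsLinear.additive linN S (w' · T) i j) (+-congˡ (IsLinear.homogeneous linN w' T i j))

  module Telescope (q : Carrier) (Φ Δ : Carrier → Series)
                   (Φ-cong : ∀ {a a'} → a ≈ a' → Φ a ≋ Φ a')
                   (Δ-cong : ∀ {a a'} → a ≈ a' → Δ a ≋ Δ a')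
                   (shift : ∀ a → Φ (a * q) ≋ Φ a ⊕ a · Δ (a * q)) where

    upward : ∀ a n → Φ (a * pow q n) ≋ Φ a ⊕ a · sum1 n (λ k → pow q (k ∸ 1) · Δ (a * pow q k))
    upward a zero i j = begin
      Φ (a * 1#) i j   ≈⟨ Φ-cong (*-identityʳ a) i j ⟩
      Φ a i j          ≈⟨ sym (+-identityʳ _) ⟩
      Φ a i j + 0#     ≈⟨ +-congˡ (sym (zeroʳ a)) ⟩
      Φ a i j + a * 0# ∎
    upward a (suc n) i j = begin
      Φ (a * pow q (suc n)) i j
        ≈⟨ Φ-cong (sym (*-assoc a (pow q n) q)) i j ⟩
      Φ (a * pow q n * q) i j
        ≈⟨ shift (a * pow q n) i j ⟩
      Φ (a * pow q n) i j + a * pow q n * Δ (a * pow q n * q) i j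
        ≈⟨ +-cong (upward a n i j) (*-congˡ (Δ-cong (*-assoc a (pow q n) q) i j)) ⟩
      Φ a i j + a * S i j + a * pow q n * Δ (a * pow q (suc n)) i j
        ≈⟨ trans (+-assoc _ _ _) (+-congˡ (factor-out a (S i j) (pow q n) _)) ⟩
      Φ a i j + a * (S i j + pow q n * Δ (a * pow q (suc n)) i j) ∎
      where
      S : Series
      S = sum1 n (λ k → pow q (k ∸ 1) · Δ (a * pow q k))

    downward : ∀ {r} → r * q ≈ 1# → ∀ a n →
               Φ (a * pow r n) ≋ Φ a ⊖ a · sum1 n (λ k → pow r k · Δ (a * q * pow r k))
    downward rq≈1 a zero i j = begin
      Φ (a * 1#) i j    ≈⟨ Φ-cong (*-identityʳ a) i j ⟩
      Φ a i j           ≈⟨ sym (+-identityʳ _) ⟩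
      Φ a i j + 0#      ≈⟨ +-congˡ (sym -0#≈0#) ⟩
      Φ a i j - 0#      ≈⟨ +-congˡ (-‿cong (sym (zeroʳ a))) ⟩
      Φ a i j - a * 0#  ∎
    downward {r} rq≈1 a (suc n) i j = begin
      Φ a' i j
        ≈⟨ isolate (sym (shift a' i j)) ⟩
      Φ (a' * q) i j - a' * Δ (a' * q) i j
        ≈⟨ +-cong (trans (Φ-cong a'q≈arⁿ i j) (downward rq≈1 a n i j)) (-‿cong (*-congˡ (Δ-cong a'q≈aqr' i j))) ⟩
      Φ a i j - a * S i j - a * pow r (suc n) * Δ (a * q * pow r (suc n)) i j
        ≈⟨ trans (sym (minus-+ _ _ _)) (+-congˡ (-‿cong (factor-out a (S i j) (pow r (suc n)) _))) ⟩
      Φ a i j - a * (S i j + pow r (suc n) * Δ (a * q * pow r (suc n)) i j) ∎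
      where
      a' : Carrier
      a' = a * pow r (suc n)
      S : Series
      S = sum1 n (λ k → pow r k · Δ (a * q * pow r k))
      a'q≈arⁿ : a' * q ≈ a * pow r n
      a'q≈arⁿ = begin
        a * (pow r n * r) * q  ≈⟨ solve 4 (λ u v w z → u :* (v :* w) :* z := u :* v :* (w :* z)) refl a (pow r n) r q ⟩
        a * pow r n * (r * q)  ≈⟨ *-congˡ rq≈1 ⟩
        a * pow r n * 1#       ≈⟨ *-identityʳ _ ⟩
        a * pow r n            ∎
      a'q≈aqr' : a' * q ≈ a * q * pow r (suc n)
      a'q≈aqr' = solve 3 (λ u v w → u :* w :* v := u :* v :* w) refl a q (pow r (suc n))

  module Contiguous (q b c c' : Carrier)
                    (hq  : ∀ j → ¬ (1# - pow q (suc j) ≈ 0#))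
                    (hc  : ∀ j → ¬ (1# - c * pow q j ≈ 0#))
                    (hc' : ∀ j → ¬ (1# - c' * pow q j ≈ 0#)) where

    κ κ' : Carrier
    κ  = (1# - b) * (1# - c) ⁻¹
    κ' = (1# - b) * (1# - c') ⁻¹

    A B : Carrier → Series
    A a = Φ4 q a (b * q) (c * q) c'
    B a = substX q (Φ4 q a (b * q) c (c' * q))

    Δ : Carrier → Series
    Δ a = κ · mulX (A a) ⊕ κ' · mulY (B a)

    Δ-cong : ∀ {a a'} → a ≈ a' → Δ a ≋ Δ a'
    Δ-cong a≈a' i j =
      +-cong (*-congˡ (IsLinear.cong mulX-linear (Φ4-cong (b * q) (c * q) c' a≈a') i j))
             (*-congˡ (IsLinear.cong mulY-linear (λ m n → *-congˡ (Φ4-cong (b * q) c (c' * q) a≈a' m n)) i j))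

    den-nonzero : ∀ m n → ¬ den q c c' m n ≈ 0#
    den-nonzero m n =
      *-nonzero (*-nonzero (*-nonzero (poch-nonzero q q hq' m) (poch-nonzero q q hq' n))
                           (poch-nonzero c q hc m))
                (poch-nonzero c' q hc' n)
      where
      hq' : ∀ j → ¬ 1# - q * pow q j ≈ 0#
      hq' j q-factor≈0 = hq j (trans (+-congˡ (-‿cong (*-comm (pow q j) q))) q-factor≈0)

    one-minus-nonzero : ∀ {z} → (∀ j → ¬ (1# - z * pow q j ≈ 0#)) → ¬ 1# - z ≈ 0#
    one-minus-nonzero {z} hz 1-z≈0 = hz 0 (trans (+-congˡ (-‿cong (*-identityʳ z))) 1-z≈0)

    x-term : ∀ a i j M → i +ℕ j P.≡ suc M →
      κ * mulX (A a) i j * den q c c' i j ≈ (1# - b) * (1# - pow q i) * (poch a q M * poch (b * q) q M)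
    x-term a zero j M _ = begin
      κ * 0# * den q c c' 0 j   ≈⟨ trans (*-congʳ (zeroʳ κ)) (zeroˡ _) ⟩
      0#                       ≈⟨ sym (trans (*-congʳ (trans (*-congˡ (-‿inverseʳ 1#)) (zeroʳ _))) (zeroˡ _)) ⟩
      (1# - b) * (1# - 1#) * (poch a q M * poch (b * q) q M) ∎
    x-term a (suc i) j M i+j+1≡M+1 = begin
      κ * Φ' * den q c c' (suc i) j  ≈⟨ *-congˡ (den-peelX q c c' i j) ⟩
      κ * Φ' * (E * (o * (1# - c)))  ≈⟨ solve 5 (λ k f e u v → k :* f :* (e :* (u :* v)) := k :* v :* (f :* e) :* u) refl κ Φ' E o (1# - c) ⟩
      κ * (1# - c) * (Φ' * E) * o    ≈⟨ *-congʳ (*-cong (div-mul (1# - b) (one-minus-nonzero hc)) (Φ4-clear i j (suc-injective i+j+1≡M+1) E≉0)) ⟩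
      (1# - b) * PB * o              ≈⟨ solve 3 (λ u v w → u :* v :* w := u :* w :* v) refl (1# - b) PB o ⟩
      (1# - b) * o * PB              ∎
      where
      Φ' E o PB : Carrier
      Φ' = A a i j
      E = den q (c * q) c' i j
      o = 1# - pow q (suc i)
      PB = poch a q M * poch (b * q) q M
      E≉0 : ¬ E ≈ 0#
      E≉0 = factor-nonzero (den-peelX q c c' i j) (den-nonzero (suc i) j)

    y-term : ∀ a i j M → i +ℕ j P.≡ suc M →
      κ' * mulY (B a) i j * den q c c' i j ≈ (1# - b) * (pow q i * (1# - pow q j)) * (poch a q M * poch (b * q) q M)
    y-term a i zero M _ = begin
      κ' * 0# * den q c c' i 0  ≈⟨ trans (*-congʳ (zeroʳ κ')) (zeroˡ _) ⟩
      0#                        ≈⟨ sym (trans (*-congʳ (trans (*-congˡ (trans (*-congˡ (-‿inverseʳ 1#)) (zeroʳ _))) (zeroʳ _))) (zeroˡ _)) ⟩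
      (1# - b) * (pow q i * (1# - 1#)) * (poch a q M * poch (b * q) q M) ∎
    y-term a i (suc j) M i+j+1≡M+1 = begin
      κ' * (pow q i * Φ') * den q c c' i (suc j)  ≈⟨ *-congˡ (den-peelY q c c' i j) ⟩
      κ' * (pow q i * Φ') * (E * (o * (1# - c')))
        ≈⟨ solve 6 (λ k p f e u v → k :* (p :* f) :* (e :* (u :* v)) := k :* v :* (f :* e) :* (p :* u)) refl κ' (pow q i) Φ' E o (1# - c') ⟩
      κ' * (1# - c') * (Φ' * E) * (pow q i * o)
        ≈⟨ *-congʳ (*-cong (div-mul (1# - b) (one-minus-nonzero hc')) (Φ4-clear i j i+j≡M E≉0)) ⟩
      (1# - b) * PB * (pow q i * o)               ≈⟨ solve 3 (λ u v w → u :* v :* w := u :* w :* v) refl (1# - b) PB (pow q i * o) ⟩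
      (1# - b) * (pow q i * o) * PB               ∎
      where
      Φ' E o PB : Carrier
      Φ' = Φ4 q a (b * q) c (c' * q) i j
      E = den q c (c' * q) i j
      o = 1# - pow q (suc j)
      PB = poch a q M * poch (b * q) q M
      i+j≡M : i +ℕ j P.≡ M
      i+j≡M = suc-injective (P.trans (P.sym (+-suc i j)) i+j+1≡M+1)
      E≉0 : ¬ E ≈ 0#
      E≉0 = factor-nonzero (den-peelY q c c' i j) (den-nonzero i (suc j))

    shift-coefficient : ∀ a i j M → i +ℕ j P.≡ suc M →
      Φ4 q (a * q) b c c' i j ≈ Φ4 q a b c c' i j + a * Δ (a * q) i j
    shift-coefficient a i j M i+j≡M+1 = *-cancelʳ-nonzero (den-nonzero i j) (begin
      Φ4 q (a * q) b c c' i j * D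
        ≈⟨ Φ4-clear i j i+j≡M+1 (den-nonzero i j) ⟩
      P * (1# - a * q * pow q M) * poch b q (suc M)
        ≈⟨ *-cong (*-congˡ last-factor) (poch-peel b q M) ⟩
      P * ((1# - a) + a * ((1# - qi) + qi * (1# - qj))) * ((1# - b) * Bq)
        ≈⟨ solve 8 (λ p r oa u ob oi v oj → p :* (oa :+ u :* (oi :+ v :* oj)) :* (ob :* r)
                      := oa :* p :* (ob :* r) :+ u :* (ob :* oi :* (p :* r) :+ ob :* (v :* oj) :* (p :* r)))
                 refl P Bq (1# - a) a (1# - b) (1# - qi) qi (1# - qj) ⟩
      (1# - a) * P * ((1# - b) * Bq) + a * ((1# - b) * (1# - qi) * (P * Bq) + (1# - b) * (qi * (1# - qj)) * (P * Bq))
        ≈⟨ sym (+-cong (trans (Φ4-clear i j i+j≡M+1 (den-nonzero i j)) (*-cong (poch-peel a q M) (poch-peel b q M)))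
                       (*-congˡ (+-cong (x-term (a * q) i j M i+j≡M+1) (y-term (a * q) i j M i+j≡M+1)))) ⟩
      Φ4 q a b c c' i j * D + a * (κ * X * D + κ' * Y * D)
        ≈⟨ solve 7 (λ f d u k x k' y → f :* d :+ u :* (k :* x :* d :+ k' :* y :* d) := (f :+ u :* (k :* x :+ k' :* y)) :* d) refl
                 (Φ4 q a b c c' i j) D a κ X κ' Y ⟩
      (Φ4 q a b c c' i j + a * (κ * X + κ' * Y)) * D ∎)
      where
      D P Bq qi qj X Y : Carrier
      D = den q c c' i j
      P = poch (a * q) q M
      Bq = poch (b * q) q M
      qi = pow q i
      qj = pow q j
      X = mulX (A (a * q)) i j
      Y = mulY (B (a * q)) i j
      last-factor : 1# - a * q * pow q M ≈ (1# - a) + a * ((1# - qi) + qi * (1# - qj))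
      last-factor = trans (+-congˡ (-‿cong (begin
          a * q * pow q M       ≈⟨ solve 3 (λ u v w → u :* v :* w := u :* (w :* v)) refl a q (pow q M) ⟩
          a * pow q (suc M)     ≈⟨ *-congˡ (reflexive (P.cong (pow q) (P.sym i+j≡M+1))) ⟩
          a * pow q (i +ℕ j)    ≈⟨ *-congˡ (pow-+ q i j) ⟩
          a * (qi * qj)         ∎))) (three-term-split a qi qj)

    shift : ∀ a → Φ4 q (a * q) b c c' ≋ Φ4 q a b c c' ⊕ a · Δ (a * q)
    shift a zero    zero    = sym (trans (+-congˡ (trans (*-congˡ Δ00≈0) (zeroʳ a))) (+-identityʳ _))
      where
      Δ00≈0 : κ * 0# + κ' * 0# ≈ 0#
      Δ00≈0 = trans (+-cong (zeroʳ κ) (zeroʳ κ')) (+-identityʳ 0#)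
    shift a (suc i) j       = shift-coefficient a (suc i) j (i +ℕ j) P.refl
    shift a zero    (suc j) = shift-coefficient a zero (suc j) j P.refl

    scaled-sum-Δ : ∀ a (w α : ℕ → Carrier) n →
      a · sum1 n (λ k → w k · Δ (α k))
        ≋ (a * (1# - b) * (1# - c) ⁻¹) · mulX (sum1 n (λ k → w k · A (α k)))
          ⊕ (a * (1# - b) * (1# - c') ⁻¹) · mulY (sum1 n (λ k → w k · B (α k)))
    scaled-sum-Δ a w α n i j = begin
      a * sum1 n (λ k → w k · Δ (α k)) i j
        ≈⟨ *-congˡ (sum1-split mulX-linear mulY-linear κ κ' w (λ k → A (α k)) (λ k → B (α k)) n i j) ⟩
      a * (κ * X + κ' * Y)
        ≈⟨ solve 6 (λ u ob oc oc' x y → u :* (ob :* oc :* x :+ ob :* oc' :* y) := u :* ob :* oc :* x :+ u :* ob :* oc' :* y)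
                 refl a (1# - b) ((1# - c) ⁻¹) ((1# - c') ⁻¹) X Y ⟩
      a * (1# - b) * (1# - c) ⁻¹ * X + a * (1# - b) * (1# - c') ⁻¹ * Y ∎
      where
      X Y : Carrier
      X = mulX (sum1 n (λ k → w k · A (α k))) i j
      Y = mulY (sum1 n (λ k → w k · B (α k))) i j

    open Telescope q (λ a → Φ4 q a b c c') Δ (Φ4-cong b c c') Δ-cong shift

    shift-up : ∀ a n →
      Φ4 q (a * pow q n) b c c'
        ≋ Φ4 q a b c c'
          ⊕ (a * (1# - b) * (1# - c) ⁻¹) · mulX (sum1 n (λ k → pow q (k ∸ 1) · A (a * pow q k)))
          ⊕ (a * (1# - b) * (1# - c') ⁻¹) · mulY (sum1 n (λ k → pow q (k ∸ 1) · B (a * pow q k)))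
    shift-up a n i j =
      trans (upward a n i j)
            (trans (+-congˡ (scaled-sum-Δ a (λ k → pow q (k ∸ 1)) (λ k → a * pow q k) n i j))
                   (sym (+-assoc _ _ _)))

    shift-down : ¬ q ≈ 0# → ∀ a n →
      Φ4 q (a * pow (q ⁻¹) n) b c c'
        ≋ Φ4 q a b c c'
          ⊖ (a * (1# - b) * (1# - c) ⁻¹) · mulX (sum1 n (λ k → pow (q ⁻¹) k · A (a * q * pow (q ⁻¹) k)))
          ⊖ (a * (1# - b) * (1# - c') ⁻¹) · mulY (sum1 n (λ k → pow (q ⁻¹) k · B (a * q * pow (q ⁻¹) k)))
    shift-down q≉0 a n i j =
      trans (downward (inverseˡ q≉0) a n i j)
            (trans (+-congˡ (-‿cong (scaled-sum-Δ a (pow (q ⁻¹)) (λ k → a * q * pow (q ⁻¹) k) n i j)))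
                   (minus-+ _ _ _))

-- Both identities hold for every n ≥ 0.
theorem14 : {ℓc ℓ : Level} (F : Field ℓc ℓ) →
  let open Field F
      open FieldDefs F
  in (q a b c c' : Carrier) →
     ¬ (q ≈ 0#) →
     (∀ j → ¬ (1# - pow q (suc j) ≈ 0#)) →
     (∀ j → ¬ (1# - c * pow q j ≈ 0#)) →
     (∀ j → ¬ (1# - c' * pow q j ≈ 0#)) →
     (n : ℕ) → 1 Data.Nat.≤ n →
     (Φ4 q (a * pow q n) b c c'
        ≋ Φ4 q a b c c'
          ⊕ (a * (1# - b) * (1# - c) ⁻¹)
              · mulX (sum1 n (λ k → pow q (k Data.Nat.∸ 1) · Φ4 q (a * pow q k) (b * q) (c * q) c'))
          ⊕ (a * (1# - b) * (1# - c') ⁻¹)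
              · mulY (sum1 n (λ k → pow q (k Data.Nat.∸ 1) · substX q (Φ4 q (a * pow q k) (b * q) c (c' * q)))))
     ×
     (Φ4 q (a * pow (q ⁻¹) n) b c c'
        ≋ Φ4 q a b c c'
          ⊖ (a * (1# - b) * (1# - c) ⁻¹)
              · mulX (sum1 n (λ k → pow (q ⁻¹) k · Φ4 q (a * q * pow (q ⁻¹) k) (b * q) (c * q) c'))
          ⊖ (a * (1# - b) * (1# - c') ⁻¹)
              · mulY (sum1 n (λ k → pow (q ⁻¹) k · substX q (Φ4 q (a * q * pow (q ⁻¹) k) (b * q) c (c' * q)))))
theorem14 F q a b c c' q≉0 hq hc hc' n _ = shift-up a n , shift-down q≉0 a n
  where open Proof.Contiguous F q b c c' hq hc hc'
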